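{- Let $T$ be a rooted tree of order $n\ge 2$ with root $r$, $\ell$ leaves and $s$ support vertices. Then: (i) $\rho(T)=s$ if and only if either $n=\ell+s$, or $n\neq \ell+s$ and every vertex of $T$ that is neither a support vertex nor a leaf is adjacent from (i.e., is an out-neighbor of) a support vertex of $T$. (ii) Let $T'$ be the rooted tree obtained from $T$ by deleting, for each support vertex $u$ of $T$, all but one of the leaves that are out-neighbors of $u$. Then $\rho(T)=\lceil (n-\ell+s)/2\rceil$ if and only if $T'\in\Phi$.
   Context: A rooted tree is a connected digraph having a vertex of in-degree $0$ (the root) such that every other vertex has in-degree $1$. A leaf is a vertex of out-degree $0$, and a support vertex is a vertex that is the in-neighbor of some leaf. For a vertex $v$ of a digraph $H$, $N^+_H[v]=\{v\}\cup\{u:(v,u)\in A(H)\}$. A set $B$ of vertices is a packing if $|N^+[v]\cap B|\le 1$ for every vertex $v$; $\rho(T)$ is the maximum size of a packing. A directed star $S_m$ is a rooted tree of order $m$ of height $1$ (a root with $m-1$ out-neighbors, all leaves). Star elimination procedure for a rooted tree $T$ with root $r$: set $T_1=T$; at step $i$, if $T_i$ is empty or consists of a single (isolated) vertex, stop; otherwise choose a leaf $v_i$ of $T_i$ at maximum distance from $r$, let $u_i$ be its in-neighbor in $T_i$, and set $T_{i+1}=T_i-N^+_{T_i}[u_i]$. If the procedure stops with an empty digraph, the sets $N^+_{T_i}[u_i]$ form a partition $\mathbb P_1$ of $V(T)$; if it stops with a single vertex (the root $r$), the sets $N^+_{T_i}[u_i]$ together with $\{r\}$ form a partition $\mathbb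 P_2$ of $V(T)$. $\Phi$ is the family of rooted trees $T$ for which (an application of) this procedure yields one of: (a) the partition $\mathbb P_1$ in which every set $N^+_{T_i}[u_i]$ induces a directed star isomorphic to $S_2$; or (b) the partition $\mathbb P_2$ in which every set $N^+_{T_i}[u_i]$ induces a directed star isomorphic to $S_2$; or (c) the partition $\mathbb P_2$ in which exactly one of the sets $N^+_{T_i}[u_i]$ induces a directed star isomorphic to $S_3$ and all others induce directed stars isomorphic to $S_2$. -}

module Defs where

open import Data.Nat using (ℕ; zero; suc; _+_; _≤_; _<_)
open import Data.Fin using (Fin; _≟_)
open import Data.Fin.Properties using () renaming (_<?_ to _<ᶠ?_)
open import Data.Bool using (Bool; true; false; _∧_; _∨_; not; if_then_else_)
open import Data.Maybe using (Maybe; just; nothing; _>>=_)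
open import Data.List using (List; []; _∷_; _++_; map; allFin)
open import Data.Nat.ListAction using (sum)
open import Data.Bool.ListAction using (any)
open import Relation.Nullary using (¬_)
open import Data.List.Relation.Unary.All using (All)
open import Data.Product using (Σ; ∃; ∃-syntax; _×_; _,_)
open import Data.Sum using (_⊎_)
open import Relation.Nullary.Decidable using (⌊_⌋)
open import Relation.Binary.PropositionalEquality using (_≡_)

-- Rooted trees on the vertex set Fin n, encoded by the in-neighbour
-- (parent) function: the arcs are exactly the pairs (u , v) with
-- par v ≡ just u.

anc : ∀ {n} → (Fin n → Maybe (Fin n)) → ℕ → Fin n → Maybe (Fin n)
anc par zero    v = just v
anc par (suc k) v = par v >>= anc par k

record RootedTree (n : ℕ) : Set where
  field
    par       : Fin n → Maybe (Fin n)
    root      : Fin n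
    root-par  : par root ≡ nothing
    root-uniq : ∀ v → par v ≡ nothing → v ≡ root
    connected : ∀ v → ∃[ k ] (anc par k v ≡ just root)

count : ∀ {n} → (Fin n → Bool) → ℕ
count {n} f = sum (map (λ i → if f i then 1 else 0) (allFin n))

module _ {n : ℕ} (T : RootedTree n) where
  open RootedTree T

  Arc : Fin n → Fin n → Set
  Arc u v = par v ≡ just u

  arcB : Fin n → Fin n → Bool
  arcB u v with par v
  ... | nothing = false
  ... | just w  = ⌊ w ≟ u ⌋

  inN⁺ : Fin n → Fin n → Bool
  inN⁺ u x = ⌊ x ≟ u ⌋ ∨ arcB u x

  isLeaf : Fin n → Bool
  isLeaf v = not (any (arcB v) (allFin n))

  isSupport : Fin n → Bool
  isSupport u = any (λ w → arcB u w ∧ isLeaf w) (allFin n)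

  numLeaves : ℕ
  numLeaves = count isLeaf

  numSupport : ℕ
  numSupport = count isSupport

  IsPacking : (Fin n → Bool) → Set
  IsPacking B = ∀ v → count (λ x → inN⁺ v x ∧ B x) ≤ 1

  PackingNumber : ℕ → Set
  PackingNumber k =
    (∃[ B ] (IsPacking B × count B ≡ k)) ×
    (∀ B → IsPacking B → count B ≤ k)

  -- Induced subdigraphs T[A] for A : Fin n → Bool (the digraphs T_i).

  data PathIn (A : Fin n → Bool) : Fin n → Fin n → ℕ → Set where
    here : ∀ {x} → A x ≡ true → PathIn A x x zero
    next : ∀ {x y z k} → A x ≡ true → Arc x y → PathIn A y z k →
           PathIn A x z (suc k)

  IsLeafIn : (Fin n → Bool) → Fin n → Set
  IsLeafIn A v = A v ≡ true × (∀ w → A w ≡ true → ¬ Arc v w)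

  MaxDist : (Fin n → Bool) → Fin n → Set
  MaxDist A v = ∀ w k k' → PathIn A root w k → PathIn A root v k' → k ≤ k'

  remove : (Fin n → Bool) → Fin n → (Fin n → Bool)
  remove A u x = A x ∧ not (inN⁺ u x)

  blockSize : (Fin n → Bool) → Fin n → ℕ
  blockSize A u = count (λ x → A x ∧ inN⁺ u x)

  data Ending : Set where
    emptyEnd  : Ending
    singleEnd : Ending

  -- Elim A ks e : some run of the star elimination procedure started at
  -- T[A] chooses stars of orders ks (in order) and stops as described by e
  data Elim (A : Fin n → Bool) : List ℕ → Ending → Set where
    stopEmpty  : (∀ v → A v ≡ false) → Elim A [] emptyEnd
    stopSingle : ∀ x → A x ≡ true → (∀ v → A v ≡ true → v ≡ x) →
                 Elim A [] singleEnd
    step       : ∀ {ks e} (v u : Fin n) →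
                 IsLeafIn A v → MaxDist A v → A u ≡ true → Arc u v →
                 Elim (remove A u) ks e →
                 Elim A (blockSize A u ∷ ks) e

  InΦ : (Fin n → Bool) → Set
  InΦ A =
    (∃[ ks ] (Elim A ks emptyEnd × All (_≡ 2) ks)) ⊎
    (∃[ ks ] (Elim A ks singleEnd × All (_≡ 2) ks)) ⊎
    (∃[ ks₁ ] ∃[ ks₂ ] (Elim A (ks₁ ++ 3 ∷ ks₂) singleEnd ×
                        All (_≡ 2) ks₁ × All (_≡ 2) ks₂))

  -- T′: delete, for each support vertex u, all but one leaf out-neighbour
  -- of u (we keep the leaf child of least index).

  keptInT′ : Fin n → Bool
  keptInT′ x =
    not (isLeaf x) ∨
    not (any (λ w → isLeaf w ∧ sibling w ∧ ⌊ w <ᶠ? x ⌋) (allFin n))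
    where
    sibling : Fin n → Bool
    sibling w with par x
    ... | nothing = false
    ... | just p  = arcB p w

module Submission where

-- A packing meets every closed out-neighbourhood N⁺[u] at most once, so if the sets N⁺[u],
-- u ∈ C, cover T then ρ(T) ≤ |C|.
--
-- (i) Keeping one leaf below each support vertex gives a packing of size s, so s ≤ ρ(T). If
-- every vertex that is neither a leaf nor a support vertex has a support in-neighbour, the
-- support vertices cover T and ρ(T) = s; a vertex v without one could be added to the kept
-- leaves, giving ρ(T) > s.
--
-- (ii) T′ has n − ℓ + s vertices. In any run of the star elimination procedure on T′ the
-- chosen leaves v_i (with the remaining root, if any) form a packing of T, and the centres
-- u_i (with that root) cover T: a deleted leaf is covered by the centre that removed its kept
-- sibling. So a run with stars of orders k_1, …, k_m, all ≥ 2, and ε ∈ {0, 1} remaining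
-- vertices gives ρ(T) = m + ε and n − ℓ + s = Σ k_i + ε. Hence ρ(T) = ⌈(n − ℓ + s)/2⌉ iff
-- Σ k_i + ε ≤ 2(m + ε), i.e. iff every k_i = 2, except that one k_i = 3 is allowed when ε = 1.

open import Defs
open import Algebra.Properties.CommutativeSemigroup using () renaming (interchange to +-interchange)
open import Data.Bool using (Bool; true; false; _∧_; _∨_; not; if_then_else_) renaming (_≟_ to _≟ᴮ_)
open import Data.Bool.ListAction using (any)
open import Data.Bool.Properties
  using (T-≡; ∨-zeroʳ; ∧-zeroʳ; ∧-identityʳ; ∧-conicalˡ; ∧-conicalʳ; not-involutive)
open import Data.Empty using (⊥-elim)
open import Data.Fin using (Fin; zero; suc; _≟_; punchIn) renaming (_<_ to _<ᶠ_)
open import Data.Fin.Induction using () renaming (<-wellFounded to <ᶠ-wellFounded)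
open import Data.Fin.Properties using (suc-injective; punchInᵢ≢i; any?)
  renaming (_<?_ to _<ᶠ?_; <-cmp to <ᶠ-cmp)
open import Data.List using (List; []; _∷_; _++_; map; allFin; length)
open import Data.List.Membership.Propositional using (_∈_; lose)
open import Data.List.Membership.Propositional.Properties using (∈-allFin)
open import Data.List.Properties using (map-tabulate)
open import Data.List.Relation.Unary.All using (All; []; _∷_)
open import Data.List.Relation.Unary.Any using (here; there; satisfied)
open import Data.List.Relation.Unary.Any.Properties using (any⁺; any⁻)
open import Data.Maybe using (just; nothing; _>>=_)
open import Data.Maybe.Properties using (just-injective)
open import Data.Nat using (ℕ; zero; suc; _+_; _*_; _∸_; _≤_; _<_; z≤n; s≤s; s≤s⁻¹; ⌈_/2⌉)
open import Data.Nat.Induction using (<-wellFounded)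
open import Data.Nat.ListAction using (sum)
open import Data.Nat.Properties hiding (suc-injective) renaming (_≟_ to _≟ℕ_)
open import Data.Product using (_×_; ∃-syntax; _,_; proj₁; proj₂)
open import Data.Sum using (_⊎_; inj₁; inj₂)
open import Function using (_∘_; id; case_of_)
open import Function.Bundles using (_⇔_; mk⇔; Equivalence)
open import Function.Properties.Equivalence using () renaming (trans to ⇔-trans; sym to ⇔-sym)
open import Induction.WellFounded using (Acc; acc)
open import Relation.Binary.Definitions using (tri<; tri≈; tri>)
open import Relation.Binary.PropositionalEquality
open import Relation.Nullary using (¬_; Dec; yes; no)
open import Relation.Nullary.Decidable using (_×-dec_; ¬?; ⌊_⌋; isYes≗does; dec-true; dec-false)

∧≡true : ∀ {a b} → a ∧ b ≡ true → a ≡ true × b ≡ true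
∧≡true {a} {b} eq = ∧-conicalˡ a b eq , ∧-conicalʳ a b eq

module _ {a} {A : Set a} where

  toWitness≡ : (a? : Dec A) → ⌊ a? ⌋ ≡ true → A
  toWitness≡ (yes a) _ = a

  fromWitness≡ : (a? : Dec A) → A → ⌊ a? ⌋ ≡ true
  fromWitness≡ a? a = trans (isYes≗does a?) (dec-true a? a)

  fromWitnessFalse≡ : (a? : Dec A) → ¬ A → ⌊ a? ⌋ ≡ false
  fromWitnessFalse≡ a? ¬a = trans (isYes≗does a?) (dec-false a? ¬a)

𝟙 : Bool → ℕ
𝟙 b = if b then 1 else 0

-- With this definition  count f  is definitionally  ∑ (𝟙 ∘ f).
∑ : ∀ {n} → (Fin n → ℕ) → ℕ
∑ {n} f = sum (map f (allFin n))

∑-suc : ∀ {n} (f : Fin (suc n) → ℕ) → ∑ f ≡ f zero + ∑ (f ∘ suc)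
∑-suc f = cong (f zero +_)
  (cong sum (trans (map-tabulate suc f) (sym (map-tabulate id (f ∘ suc)))))

∑-cong : ∀ {n} {f g : Fin n → ℕ} → (∀ x → f x ≡ g x) → ∑ f ≡ ∑ g
∑-cong {zero}  f≗g = refl
∑-cong {suc n} {f} {g} f≗g = begin
  ∑ f                   ≡⟨ ∑-suc f ⟩
  f zero + ∑ (f ∘ suc)  ≡⟨ cong₂ _+_ (f≗g zero) (∑-cong (f≗g ∘ suc)) ⟩
  g zero + ∑ (g ∘ suc)  ≡⟨ ∑-suc g ⟨
  ∑ g                   ∎
  where open ≡-Reasoning

∑-mono-≤ : ∀ {n} {f g : Fin n → ℕ} → (∀ x → f x ≤ g x) → ∑ f ≤ ∑ g
∑-mono-≤ {zero}  f≤g = z≤n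
∑-mono-≤ {suc n} {f} {g} f≤g
  rewrite ∑-suc f | ∑-suc g = +-mono-≤ (f≤g zero) (∑-mono-≤ (f≤g ∘ suc))

∑-distrib-+ : ∀ {n} (f g : Fin n → ℕ) → ∑ (λ x → f x + g x) ≡ ∑ f + ∑ g
∑-distrib-+ {zero}  f g = refl
∑-distrib-+ {suc n} f g
  rewrite ∑-suc (λ x → f x + g x) | ∑-suc f | ∑-suc g | ∑-distrib-+ (f ∘ suc) (g ∘ suc) =
  +-interchange +-commutativeSemigroup (f zero) (g zero) (∑ (f ∘ suc)) (∑ (g ∘ suc))

∑-const : ∀ n (c : ℕ) → ∑ {n} (λ _ → c) ≡ n * c
∑-const zero    c = refl
∑-const (suc n) c = trans (∑-suc {n} (λ _ → c)) (cong (c +_) (∑-const n c))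

∑-zero : ∀ {n} {f : Fin n → ℕ} → (∀ x → f x ≡ 0) → ∑ f ≡ 0
∑-zero {n} f≗0 = trans (∑-cong {n} f≗0) (trans (∑-const n 0) (*-zeroʳ n))

∑-comm : ∀ {m n} (f : Fin m → Fin n → ℕ) →
         ∑ (λ x → ∑ (f x)) ≡ ∑ (λ y → ∑ (λ x → f x y))
∑-comm {zero}  f = sym (∑-zero {f = λ y → ∑ (λ x → f x y)} λ _ → refl)
∑-comm {suc m} f = begin
  ∑ (λ x → ∑ (f x))                                  ≡⟨ ∑-suc (λ x → ∑ (f x)) ⟩
  ∑ (f zero) + ∑ (λ x → ∑ (f (suc x)))               ≡⟨ cong (∑ (f zero) +_) (∑-comm (f ∘ suc)) ⟩
  ∑ (f zero) + ∑ (λ y → ∑ (λ x → f (suc x) y))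
    ≡⟨ ∑-distrib-+ (f zero) (λ y → ∑ (λ x → f (suc x) y)) ⟨
  ∑ (λ y → f zero y + ∑ (λ x → f (suc x) y))         ≡⟨ ∑-cong (λ y → ∑-suc (λ x → f x y)) ⟨
  ∑ (λ y → ∑ (λ x → f x y))                          ∎
  where open ≡-Reasoning

∑-single : ∀ {n} {f : Fin n → ℕ} x → (∀ y → y ≢ x → f y ≡ 0) → ∑ f ≡ f x
∑-single {suc n} {f} zero    f≗0 =
  trans (∑-suc f) (trans (cong (f zero +_) (∑-zero (λ y → f≗0 (suc y) λ ())))
                         (+-identityʳ (f zero)))
∑-single {suc n} {f} (suc x) f≗0 =
  trans (∑-suc f) (cong₂ _+_ (f≗0 zero λ ()) (∑-single x (λ y y≢x → f≗0 (suc y) (y≢x ∘ suc-injective))))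

≤-∑ : ∀ {n} {f : Fin n → ℕ} x → f x ≤ ∑ f
≤-∑ {f = f} zero    rewrite ∑-suc f = m≤m+n _ _
≤-∑ {f = f} (suc x) rewrite ∑-suc f = ≤-trans (≤-∑ x) (m≤n+m _ _)

∑-positive : ∀ {n} {f : Fin n → ℕ} → 0 < ∑ f → ∃[ x ] 0 < f x
∑-positive {zero}  ()
∑-positive {suc n} {f} 0<∑ rewrite ∑-suc f with f zero in f0≡
... | suc _ = zero , subst (0 <_) (sym f0≡) (s≤s z≤n)
... | zero  = let x , 0<fx = ∑-positive {f = f ∘ suc} 0<∑ in suc x , 0<fx

module _ {n : ℕ} where

  count-cong : {f g : Fin n → Bool} → (∀ x → f x ≡ g x) → count f ≡ count g
  count-cong f≗g = ∑-cong (cong 𝟙 ∘ f≗g)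

  count-mono : {f g : Fin n → Bool} → (∀ x → f x ≡ true → g x ≡ true) → count f ≤ count g
  count-mono {f} {g} f⊆g = ∑-mono-≤ λ x → 𝟙-mono (f x) (g x) (f⊆g x)
    where
    𝟙-mono : ∀ a b → (a ≡ true → b ≡ true) → 𝟙 a ≤ 𝟙 b
    𝟙-mono false b a⇒b = z≤n
    𝟙-mono true  b a⇒b rewrite a⇒b refl = ≤-refl

  count-split : (f g : Fin n → Bool) →
                count f ≡ count (λ x → f x ∧ g x) + count (λ x → f x ∧ not (g x))
  count-split f g = trans (∑-cong λ x → 𝟙-split (f x) (g x))
                          (∑-distrib-+ (λ x → 𝟙 (f x ∧ g x)) (λ x → 𝟙 (f x ∧ not (g x))))
    where
    𝟙-split : ∀ a b → 𝟙 a ≡ 𝟙 (a ∧ b) + 𝟙 (a ∧ not b)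
    𝟙-split false b     = refl
    𝟙-split true  false = refl
    𝟙-split true  true  = refl

  count-none : {f : Fin n → Bool} → (∀ x → f x ≡ false) → count f ≡ 0
  count-none f≗false = ∑-zero (cong 𝟙 ∘ f≗false)

  count-pos : {f : Fin n → Bool} {x : Fin n} → f x ≡ true → 0 < count f
  count-pos {f} {x} fx = ≤-trans (≤-reflexive (cong 𝟙 (sym fx))) (≤-∑ x)

  count-witness : {f : Fin n → Bool} → 0 < count f → ∃[ x ] f x ≡ true
  count-witness {f} 0<count with ∑-positive 0<count
  ... | x , 0<𝟙fx with f x in fx
  ...   | true = x , fx

  count-single : {f : Fin n → Bool} (x : Fin n) → f x ≡ true →
                 (∀ y → f y ≡ true → y ≡ x) → count f ≡ 1
  count-single {f} x fx only-x = trans (∑-single x off-x) (cong 𝟙 fx)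
    where
    off-x : ∀ y → y ≢ x → 𝟙 (f y) ≡ 0
    off-x y y≢x with f y in fy
    ... | false = refl
    ... | true  = ⊥-elim (y≢x (only-x y fy))

  count≤1 : {f : Fin n → Bool} → (∀ {x y} → f x ≡ true → f y ≡ true → x ≡ y) → count f ≤ 1
  count≤1 {f} unique with count f in eq
  ... | zero  = z≤n
  ... | suc _ = let x , fx = count-witness {f} (subst (0 <_) (sym eq) (s≤s z≤n))
                in ≤-reflexive (trans (sym eq) (count-single x fx λ y fy → unique fy fx))

  count-≟ : (v : Fin n) → count (λ x → ⌊ x ≟ v ⌋) ≡ 1
  count-≟ v = count-single v (fromWitness≡ (v ≟ v) refl) λ y → toWitness≡ (y ≟ v)

  count-insert : {f : Fin n → Bool} (v : Fin n) → f v ≡ false →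
                 count (λ x → ⌊ x ≟ v ⌋ ∨ f x) ≡ suc (count f)
  count-insert {f} v fv = begin
    count (λ x → ⌊ x ≟ v ⌋ ∨ f x)            ≡⟨ ∑-cong 𝟙-∨ ⟩
    ∑ (λ x → 𝟙 ⌊ x ≟ v ⌋ + 𝟙 (f x))         ≡⟨ ∑-distrib-+ (λ x → 𝟙 ⌊ x ≟ v ⌋) (𝟙 ∘ f) ⟩
    count (λ x → ⌊ x ≟ v ⌋) + count f        ≡⟨ cong (_+ count f) (count-≟ v) ⟩
    suc (count f)                            ∎
    where
    open ≡-Reasoning
    𝟙-∨ : ∀ x → 𝟙 (⌊ x ≟ v ⌋ ∨ f x) ≡ 𝟙 ⌊ x ≟ v ⌋ + 𝟙 (f x)
    𝟙-∨ x with x ≟ v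
    ... | yes refl rewrite fv = refl
    ... | no  _    = refl

  count-complement : (f : Fin n → Bool) → count f + count (not ∘ f) ≡ n
  count-complement f = begin
    count f + count (not ∘ f)          ≡⟨ ∑-distrib-+ (𝟙 ∘ f) (𝟙 ∘ not ∘ f) ⟨
    ∑ (λ x → 𝟙 (f x) + 𝟙 (not (f x)))  ≡⟨ ∑-cong (λ x → 𝟙-complement (f x)) ⟩
    ∑ {n} (λ _ → 1)                    ≡⟨ ∑-const n 1 ⟩
    n * 1                              ≡⟨ *-identityʳ n ⟩
    n                                  ∎
    where
    open ≡-Reasoning
    𝟙-complement : ∀ b → 𝟙 b + 𝟙 (not b) ≡ 1
    𝟙-complement false = refl
    𝟙-complement true  = refl

  count≡n⇒all : {f : Fin n → Bool} → count f ≡ n → ∀ x → f x ≡ true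
  count≡n⇒all {f} count≡n x with f x in fx
  ... | true  = refl
  ... | false = ⊥-elim (<-irrefl refl (begin-strict
    n                           ≡⟨ count≡n ⟨
    count f                     <⟨ m<m+n (count f) (count-pos {not ∘ f} (cong not fx)) ⟩
    count f + count (not ∘ f)   ≡⟨ count-complement f ⟩
    n                           ∎))
    where open ≤-Reasoning

  count-double : (R : Fin n → Fin n → Bool) {f g : Fin n → Bool} →
                 (∀ x → count (λ u → R u x) ≡ 𝟙 (f x)) →
                 (∀ u → count (R u) ≡ 𝟙 (g u)) →
                 count f ≡ count g
  count-double R column row =
    trans (∑-cong (sym ∘ column)) (trans (∑-comm (λ x u → 𝟙 (R u x))) (∑-cong row))

  count-≤-cover : (N : Fin n → Fin n → Bool) {B C : Fin n → Bool} →
                  (∀ u → count (λ x → N u x ∧ B x) ≤ 1) →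
                  (∀ x → B x ≡ true → ∃[ u ] (C u ≡ true × N u x ≡ true)) →
                  count B ≤ count C
  count-≤-cover N {B} {C} N-sparse covered = begin
    count B                                           ≤⟨ ∑-mono-≤ B≤covers ⟩
    ∑ (λ x → count (λ u → C u ∧ (N u x ∧ B x)))       ≡⟨ ∑-comm (λ x u → 𝟙 (C u ∧ (N u x ∧ B x))) ⟩
    ∑ (λ u → count (λ x → C u ∧ (N u x ∧ B x)))       ≤⟨ ∑-mono-≤ covers≤C ⟩
    count C                                           ∎
    where
    open ≤-Reasoning
    B≤covers : ∀ x → 𝟙 (B x) ≤ count (λ u → C u ∧ (N u x ∧ B x))
    B≤covers x with B x in bx
    ... | false = z≤n
    ... | true  = let u , cu , nux = covered x bx
                  in count-pos {x = u} (cong₂ (λ c d → c ∧ (d ∧ true)) cu nux)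
    covers≤C : ∀ u → count (λ x → C u ∧ (N u x ∧ B x)) ≤ 𝟙 (C u)
    covers≤C u with C u
    ... | false = ≤-reflexive (count-none {f = λ _ → false} λ _ → refl)
    ... | true  = N-sparse u

module _ {n : ℕ} where

  any-allFin⁺ : (p : Fin n → Bool) {x : Fin n} → p x ≡ true → any p (allFin n) ≡ true
  any-allFin⁺ p {x} px =
    Equivalence.to T-≡ (any⁺ p (lose (∈-allFin x) (Equivalence.from T-≡ px)))

  any-allFin⁻ : (p : Fin n → Bool) → any p (allFin n) ≡ true → ∃[ x ] p x ≡ true
  any-allFin⁻ p any≡true =
    let x , px = satisfied (any⁻ p (allFin n) (Equivalence.from T-≡ any≡true))
    in x , Equivalence.to T-≡ px

  argmax : (A : Fin n → Bool) (f : Fin n → ℕ) {x : Fin n} → A x ≡ true →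
           ∃[ m ] (A m ≡ true × ∀ {w} → A w ≡ true → f w ≤ f m)
  argmax A f {x} ax =
    let m , am , _ , max = go (allFin n) ax in m , am , λ {w} aw → max (∈-allFin w) aw
    where
    go : ∀ xs {b} → A b ≡ true →
         ∃[ m ] (A m ≡ true × f b ≤ f m × ∀ {w} → w ∈ xs → A w ≡ true → f w ≤ f m)
    go []       {b} ab = b , ab , ≤-refl , λ ()
    go (w ∷ ws) {b} ab with A w in aw | f b ≤? f w
    ... | true | yes b≤w = let m , am , w≤m , max = go ws aw in
      m , am , ≤-trans b≤w w≤m , λ { (here refl) _ → w≤m ; (there w∈) → max w∈ }
    ... | true | no  b≰w = let m , am , b≤m , max = go ws ab in
      m , am , b≤m , λ { (here refl) _ → ≤-trans (<⇒≤ (≰⇒> b≰w)) b≤m ; (there w∈) → max w∈ }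
    ... | false | _ = let m , am , b≤m , max = go ws ab in
      m , am , b≤m , λ { (here refl) aw′ → case trans (sym aw′) aw of λ () ; (there w∈) → max w∈ }

n≤⌈n/2⌉+⌈n/2⌉ : ∀ m → m ≤ ⌈ m /2⌉ + ⌈ m /2⌉
n≤⌈n/2⌉+⌈n/2⌉ m =
  subst (_≤ ⌈ m /2⌉ + ⌈ m /2⌉) (⌊n/2⌋+⌈n/2⌉≡n m) (+-monoˡ-≤ ⌈ m /2⌉ (⌊n/2⌋≤⌈n/2⌉ m))

≡⌈/2⌉⇔≤double : ∀ {m r} → r + r ≤ suc m → (r ≡ ⌈ m /2⌉ ⇔ m ≤ r + r)
≡⌈/2⌉⇔≤double {m} {r} r+r≤1+m = mk⇔
  (λ { refl → n≤⌈n/2⌉+⌈n/2⌉ m })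
  (λ m≤r+r → ≤-antisym
    (subst (_≤ ⌈ m /2⌉) (sym (n≡⌊n+n/2⌋ r)) (⌊n/2⌋-mono r+r≤1+m))
    (subst (⌈ m /2⌉ ≤_) (sym (n≡⌈n+n/2⌉ r)) (⌈n/2⌉-mono m≤r+r)))

double-suc : ∀ m → suc m + suc m ≡ 2 + (m + m)
double-suc m = cong suc (+-suc m m)

sum≥double : ∀ {ks} → All (2 ≤_) ks → length ks + length ks ≤ sum ks
sum≥double []                   = z≤n
sum≥double {k ∷ ks} (2≤k ∷ ps) =
  subst (_≤ k + sum ks) (sym (double-suc (length ks))) (+-mono-≤ 2≤k (sum≥double ps))

sum-all≡2 : ∀ {ks} → All (_≡ 2) ks → sum ks ≡ length ks + length ks
sum-all≡2             []          = refl
sum-all≡2 {_ ∷ ks} (refl ∷ twos) =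
  trans (cong (2 +_) (sum-all≡2 twos)) (sym (double-suc (length ks)))

sum-one-3 : ∀ {ks₁ ks₂} → All (_≡ 2) ks₁ → All (_≡ 2) ks₂ →
            sum (ks₁ ++ 3 ∷ ks₂) ≡ suc (length (ks₁ ++ 3 ∷ ks₂) + length (ks₁ ++ 3 ∷ ks₂))
sum-one-3 {[]}      {ks₂} []            twos₂ =
  cong (2 +_) (trans (cong suc (sum-all≡2 twos₂)) (sym (+-suc (length ks₂) (length ks₂))))
sum-one-3 {_ ∷ ks₁} {ks₂} (refl ∷ twos₁) twos₂ =
  trans (cong (2 +_) (sum-one-3 twos₁ twos₂)) (cong suc (sym (double-suc (length (ks₁ ++ 3 ∷ ks₂)))))

all≡2 : ∀ {ks} → All (2 ≤_) ks → sum ks ≤ length ks + length ks → All (_≡ 2) ks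
all≡2             []           _     = []
all≡2 {k ∷ ks} (2≤k ∷ ps) tight rewrite double-suc (length ks) =
  ≤-antisym k≤2 2≤k ∷ all≡2 ps (+-cancelˡ-≤ 2 _ _ (≤-trans (+-monoˡ-≤ (sum ks) 2≤k) tight))
  where
  k≤2 : k ≤ 2
  k≤2 = +-cancelʳ-≤ (sum ks) k 2 (≤-trans tight (+-monoʳ-≤ 2 (sum≥double ps)))

all≡2-or-one-3 : ∀ {ks} → All (2 ≤_) ks → sum ks ≤ suc (length ks + length ks) →
                 All (_≡ 2) ks ⊎
                 ∃[ ks₁ ] ∃[ ks₂ ] (ks ≡ ks₁ ++ 3 ∷ ks₂ × All (_≡ 2) ks₁ × All (_≡ 2) ks₂)
all≡2-or-one-3             []          _     = inj₁ []
all≡2-or-one-3 {k ∷ ks} (2≤k ∷ ps) tight rewrite double-suc (length ks) with k ≤? 2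
... | yes k≤2 with all≡2-or-one-3 ps (+-cancelˡ-≤ 2 _ _ (≤-trans (+-monoˡ-≤ (sum ks) 2≤k) tight))
...   | inj₁ twos = inj₁ (≤-antisym k≤2 2≤k ∷ twos)
...   | inj₂ (ks₁ , ks₂ , refl , twos₁ , twos₂) =
        inj₂ (k ∷ ks₁ , ks₂ , refl , ≤-antisym k≤2 2≤k ∷ twos₁ , twos₂)
all≡2-or-one-3 {k ∷ ks} (2≤k ∷ ps) tight | no k≰2 =
  inj₂ ([] , ks , cong (_∷ ks) k≡3 , [] ,
        all≡2 ps (+-cancelˡ-≤ 3 _ _ (subst (λ j → j + sum ks ≤ _) k≡3 tight)))
  where
  k≡3 : k ≡ 3
  k≡3 = ≤-antisym (+-cancelʳ-≤ (sum ks) k 3 (≤-trans tight (+-monoʳ-≤ 3 (sum≥double ps)))) (≰⇒> k≰2)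

module _ {n : ℕ} (T : RootedTree n) where
  open RootedTree T

  arcB⇒Arc : ∀ {u v} → arcB T u v ≡ true → Arc T u v
  arcB⇒Arc {u} {v} eq with par v
  ... | just w = cong just (toWitness≡ (w ≟ u) eq)

  Arc⇒arcB : ∀ {u v} → Arc T u v → arcB T u v ≡ true
  Arc⇒arcB {u} pv≡u rewrite pv≡u = fromWitness≡ (u ≟ u) refl

  Arc-functional : ∀ {u w x} → Arc T u x → Arc T w x → u ≡ w
  Arc-functional ux wx = just-injective (trans (sym ux) wx)

  ¬Arc-root : ∀ {p} → ¬ Arc T p root
  ¬Arc-root p→root with () ← trans (sym root-par) p→root

  inN⁺⇒ : ∀ {u x} → inN⁺ T u x ≡ true → x ≡ u ⊎ Arc T u x
  inN⁺⇒ {u} {x} eq with x ≟ u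
  ... | yes x≡u = inj₁ x≡u
  ... | no  _   = inj₂ (arcB⇒Arc eq)

  inN⁺-refl : ∀ u → inN⁺ T u u ≡ true
  inN⁺-refl u rewrite fromWitness≡ (u ≟ u) refl = refl

  Arc⇒inN⁺ : ∀ {u x} → Arc T u x → inN⁺ T u x ≡ true
  Arc⇒inN⁺ ux rewrite Arc⇒arcB ux = ∨-zeroʳ _

  isLeaf⇒¬Arc : ∀ {v w} → isLeaf T v ≡ true → ¬ Arc T v w
  isLeaf⇒¬Arc leaf vw
    with () ← trans (sym leaf) (cong not (any-allFin⁺ (arcB T _) (Arc⇒arcB vw)))

  Arc⇒¬isLeaf : ∀ {v w} → Arc T v w → isLeaf T v ≡ false
  Arc⇒¬isLeaf {v} vw with isLeaf T v in leaf
  ... | false = refl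
  ... | true  = ⊥-elim (isLeaf⇒¬Arc leaf vw)

  isSupport⇒leafChild : ∀ {u} → isSupport T u ≡ true → ∃[ w ] (Arc T u w × isLeaf T w ≡ true)
  isSupport⇒leafChild support =
    let w , uw∧leaf = any-allFin⁻ (λ w → arcB T _ w ∧ isLeaf T w) support
        uw , leaf = ∧≡true uw∧leaf
    in w , arcB⇒Arc uw , leaf

  leafChild⇒isSupport : ∀ {u w} → Arc T u w → isLeaf T w ≡ true → isSupport T u ≡ true
  leafChild⇒isSupport {u} uw leaf = any-allFin⁺ (λ w → arcB T u w ∧ isLeaf T w) (cong₂ _∧_ (Arc⇒arcB uw) leaf)

  isSupport⇒¬isLeaf : ∀ {u} → isSupport T u ≡ true → isLeaf T u ≡ false
  isSupport⇒¬isLeaf support = Arc⇒¬isLeaf (proj₁ (proj₂ (isSupport⇒leafChild support)))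

  depth : Fin n → ℕ
  depth v = proj₁ (connected v)

  anc-root : ∀ k → anc par (suc k) root ≡ nothing
  anc-root k = cong (_>>= anc par k) root-par

  depth-unique : ∀ {k x} → anc par k x ≡ just root → k ≡ depth x
  depth-unique {k} {x} = go (proj₂ (connected x))
    where
    go : ∀ {k k′ x} → anc par k′ x ≡ just root → anc par k x ≡ just root → k ≡ k′
    go {zero}  {zero}   _  _  = refl
    go {zero}  {suc k′} x↑ x≡root with refl ← just-injective x≡root
      with () ← trans (sym (anc-root k′)) x↑
    go {suc k} {zero}   x≡root x↑ with refl ← just-injective x≡root
      with () ← trans (sym (anc-root k)) x↑
    go {suc k} {suc k′} {x} x↑ x↑′ with par x
    ... | just p = cong suc (go x↑ x↑′)

  depth-child : ∀ {u v} → Arc T u v → depth v ≡ suc (depth u)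
  depth-child {u} uv =
    sym (depth-unique (trans (cong (_>>= anc par (depth u)) uv) (proj₂ (connected u))))

  Arc-irreflexive : ∀ {v} → ¬ Arc T v v
  Arc-irreflexive vv = 1+n≢n (sym (depth-child vv))

  depth≡0⇒root : ∀ {v} → depth v ≡ 0 → v ≡ root
  depth≡0⇒root {v} d≡0 = just-injective (subst (λ k → anc par k v ≡ just root) d≡0 (proj₂ (connected v)))

  nonRoot⇒parent : ∀ {x} → x ≢ root → ∃[ p ] Arc T p x
  nonRoot⇒parent {x} x≢root with par x in px
  ... | just p  = p , refl
  ... | nothing = ⊥-elim (x≢root (root-uniq x px))

  ancestor⇒child : ∀ k {v r} → anc par (suc k) v ≡ just r → ∃[ w ] Arc T r w
  ancestor⇒child k {v} v↑ with par v in pv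
  ancestor⇒child zero    {v} v↑ | just p = v , trans pv v↑
  ancestor⇒child (suc k) {v} v↑ | just p = ancestor⇒child k v↑

  root-¬isLeaf : 2 ≤ n → isLeaf T root ≡ false
  root-¬isLeaf 2≤n with isLeaf T root in leaf
  ... | false = refl
  ... | true  = ⊥-elim (isLeaf⇒¬Arc leaf (proj₂ root-child))
    where
    other : ∀ {m} → 2 ≤ m → (r : Fin m) → ∃[ v ] v ≢ r
    other (s≤s (s≤s _)) r = punchIn r zero , punchInᵢ≢i r zero
    root-child : ∃[ w ] Arc T root w
    root-child with other 2≤n root
    ... | v , v≢root with depth v in dv
    ...   | zero  = ⊥-elim (v≢root (depth≡0⇒root dv))
    ...   | suc k = ancestor⇒child k (subst (λ k → anc par k v ≡ just root) dv (proj₂ (connected v)))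

  leaf-has-parent : 2 ≤ n → ∀ {x} → isLeaf T x ≡ true → ∃[ p ] Arc T p x
  leaf-has-parent 2≤n leaf = nonRoot⇒parent λ { refl → case trans (sym leaf) (root-¬isLeaf 2≤n) of λ () }

  -- Distinct x and y lie in a common N⁺[p] exactly when they are not apart.
  Apart : Fin n → Fin n → Set
  Apart x y = ¬ Arc T x y × ¬ Arc T y x × (∀ {p} → Arc T p x → ¬ Arc T p y)

  Apart-sym : ∀ {x y} → Apart x y → Apart y x
  Apart-sym (¬xy , ¬yx , ¬siblings) = ¬yx , ¬xy , λ py px → ¬siblings px py

  Scattered : (Fin n → Bool) → Set
  Scattered B = ∀ {x y} → B x ≡ true → B y ≡ true → x ≢ y → Apart x y

  Scattered⇒IsPacking : ∀ {B} → Scattered B → IsPacking T B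
  Scattered⇒IsPacking {B} scattered y = count≤1 same
    where
    same : ∀ {x₁ x₂} → inN⁺ T y x₁ ∧ B x₁ ≡ true → inN⁺ T y x₂ ∧ B x₂ ≡ true → x₁ ≡ x₂
    same {x₁} {x₂} in₁ in₂ with x₁ ≟ x₂
    ... | yes x₁≡x₂ = x₁≡x₂
    ... | no  x₁≢x₂ with ∧≡true {inN⁺ T y x₁} in₁ | ∧≡true {inN⁺ T y x₂} in₂
    ...   | y₁ , b₁ | y₂ , b₂ with scattered b₁ b₂ x₁≢x₂ | inN⁺⇒ {y} {x₁} y₁ | inN⁺⇒ {y} {x₂} y₂
    ...     | _ , _ , _       | inj₁ refl | inj₁ refl = ⊥-elim (x₁≢x₂ refl)
    ...     | ¬x₁x₂ , _ , _   | inj₁ refl | inj₂ yx₂  = ⊥-elim (¬x₁x₂ yx₂)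
    ...     | _ , ¬x₂x₁ , _   | inj₂ yx₁  | inj₁ refl = ⊥-elim (¬x₂x₁ yx₁)
    ...     | _ , _ , ¬siblings | inj₂ yx₁ | inj₂ yx₂ = ⊥-elim (¬siblings yx₁ yx₂)

  Scattered-insert : ∀ {B} v → Scattered B → (∀ {x} → B x ≡ true → x ≢ v → Apart v x) →
                     Scattered (λ x → ⌊ x ≟ v ⌋ ∨ B x)
  Scattered-insert {B} v scattered apart {x} {y} in-x in-y x≢y with x ≟ v | y ≟ v
  ... | yes refl | yes refl = ⊥-elim (x≢y refl)
  ... | yes refl | no  y≢v  = apart in-y y≢v
  ... | no  x≢v  | yes refl = Apart-sym (apart in-x x≢v)
  ... | no  _    | no  _    = scattered in-x in-y x≢y

  AncestorClosed : (Fin n → Bool) → Set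
  AncestorClosed A = ∀ {p x} → Arc T p x → A x ≡ true → A p ≡ true

  keptLeaf : Fin n → Bool
  keptLeaf x = isLeaf T x ∧ keptInT′ T x

  ¬isLeaf⇒keptInT′ : ∀ {x} → isLeaf T x ≡ false → keptInT′ T x ≡ true
  ¬isLeaf⇒keptInT′ ¬leaf rewrite ¬leaf = refl

  ¬keptInT′⇒isLeaf : ∀ {x} → keptInT′ T x ≡ false → isLeaf T x ≡ true
  ¬keptInT′⇒isLeaf {x} ¬kept with isLeaf T x in leaf
  ... | true  = refl
  ... | false = case ¬kept of λ ()

  T′-closed : AncestorClosed (keptInT′ T)
  T′-closed px _ = ¬isLeaf⇒keptInT′ (Arc⇒¬isLeaf px)

  smallerLeafSibling : Fin n → Fin n → Fin n → Bool
  smallerLeafSibling p x w = isLeaf T w ∧ arcB T p w ∧ ⌊ w <ᶠ? x ⌋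

  keptInT′-leaf : ∀ {p x} → Arc T p x → isLeaf T x ≡ true →
                  keptInT′ T x ≡ not (any (smallerLeafSibling p x) (allFin n))
  keptInT′-leaf px leaf rewrite px | leaf = refl

  keptLeaf-least : ∀ {p x w} → Arc T p x → keptLeaf x ≡ true →
                   Arc T p w → isLeaf T w ≡ true → ¬ w <ᶠ x
  keptLeaf-least {p} {x} {w} px kept pw leaf-w w<x =
    let leaf-x , kept-x = ∧≡true {isLeaf T x} kept
    in case trans (sym kept-x) (trans (keptInT′-leaf px leaf-x) (cong not smaller)) of λ ()
    where
    smaller : any (smallerLeafSibling p x) (allFin n) ≡ true
    smaller = any-allFin⁺ (smallerLeafSibling p x)
                (cong₂ _∧_ leaf-w (cong₂ _∧_ (Arc⇒arcB pw) (fromWitness≡ (w <ᶠ? x) w<x)))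

  keptLeaf-unique : ∀ {p x y} → Arc T p x → Arc T p y →
                    keptLeaf x ≡ true → keptLeaf y ≡ true → x ≡ y
  keptLeaf-unique {x = x} {y} px py kept-x kept-y with <ᶠ-cmp x y
  ... | tri< x<y _ _ = ⊥-elim (keptLeaf-least py kept-y px (proj₁ (∧≡true kept-x)) x<y)
  ... | tri≈ _ x≡y _ = x≡y
  ... | tri> _ _ y<x = ⊥-elim (keptLeaf-least px kept-x py (proj₁ (∧≡true kept-y)) y<x)

  keptLeaf-exists : ∀ {p x} → Arc T p x → isLeaf T x ≡ true →
                    ∃[ m ] (Arc T p m × keptLeaf m ≡ true)
  keptLeaf-exists {p} {x} = go (<ᶠ-wellFounded x)
    where
    go : ∀ {x} → Acc _<ᶠ_ x → Arc T p x → isLeaf T x ≡ true → ∃[ m ] (Arc T p m × keptLeaf m ≡ true)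
    go {x} (acc smaller) px leaf with keptInT′ T x in kept
    ... | true  = x , px , cong₂ _∧_ leaf kept
    ... | false =
      let w , sibling = any-allFin⁻ (smallerLeafSibling p x)
                          (trans (sym (not-involutive _)) (cong not (trans (sym (keptInT′-leaf px leaf)) kept)))
          leaf-w , rest = ∧≡true {isLeaf T w} sibling
          pw , w<x = ∧≡true {arcB T p w} rest
      in go (smaller (toWitness≡ (w <ᶠ? x) w<x)) (arcB⇒Arc pw) leaf-w

  keptLeaf-scattered : Scattered keptLeaf
  keptLeaf-scattered kept-x kept-y x≢y =
      isLeaf⇒¬Arc (proj₁ (∧≡true kept-x))
    , isLeaf⇒¬Arc (proj₁ (∧≡true kept-y))
    , λ px py → x≢y (keptLeaf-unique px py kept-x kept-y)

  count-keptLeaf : 2 ≤ n → count keptLeaf ≡ numSupport T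
  count-keptLeaf 2≤n = count-double (λ u x → arcB T u x ∧ keptLeaf x) one-parent one-kept-child
    where
    one-parent : ∀ x → count (λ u → arcB T u x ∧ keptLeaf x) ≡ 𝟙 (keptLeaf x)
    one-parent x with keptLeaf x in kept
    ... | false = count-none λ u → ∧-zeroʳ (arcB T u x)
    ... | true  =
      let p , px = leaf-has-parent 2≤n (proj₁ (∧≡true kept))
      in count-single p (trans (∧-identityʳ _) (Arc⇒arcB px))
           λ u ux → Arc-functional (arcB⇒Arc (trans (sym (∧-identityʳ _)) ux)) px
    one-kept-child : ∀ u → count (λ x → arcB T u x ∧ keptLeaf x) ≡ 𝟙 (isSupport T u)
    one-kept-child u with isSupport T u in support
    ... | true  =
      let w , uw , leaf-w = isSupport⇒leafChild support
          m , um , kept-m = keptLeaf-exists uw leaf-w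
      in count-single m (cong₂ _∧_ (Arc⇒arcB um) kept-m)
           λ y uy∧kept → let uy , kept-y = ∧≡true uy∧kept
                         in keptLeaf-unique (arcB⇒Arc uy) um kept-y kept-m
    ... | false = count-none none
      where
      none : ∀ x → arcB T u x ∧ keptLeaf x ≡ false
      none x with arcB T u x in ux | keptLeaf x in kept
      ... | false | _     = refl
      ... | true  | false = refl
      ... | true  | true
        with () ← trans (sym support) (leafChild⇒isSupport (arcB⇒Arc ux) (proj₁ (∧≡true kept)))

  count-T′ : 2 ≤ n → count (keptInT′ T) ≡ n ∸ numLeaves T + numSupport T
  count-T′ 2≤n = begin
    count (keptInT′ T)                                         ≡⟨ count-split (keptInT′ T) (not ∘ isLeaf T) ⟩
    count (λ x → keptInT′ T x ∧ not (isLeaf T x)) +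
    count (λ x → keptInT′ T x ∧ not (not (isLeaf T x)))
      ≡⟨ cong₂ _+_ (count-cong internal) (count-cong leaf) ⟩
    count (not ∘ isLeaf T) + count keptLeaf                    ≡⟨ cong₂ _+_ internal-count (count-keptLeaf 2≤n) ⟩
    n ∸ numLeaves T + numSupport T                             ∎
    where
    open ≡-Reasoning
    internal : ∀ x → keptInT′ T x ∧ not (isLeaf T x) ≡ not (isLeaf T x)
    internal x with isLeaf T x
    ... | true  = ∧-zeroʳ _
    ... | false = refl
    leaf : ∀ x → keptInT′ T x ∧ not (not (isLeaf T x)) ≡ keptLeaf x
    leaf x with isLeaf T x
    ... | true  = ∧-identityʳ _
    ... | false = refl
    internal-count : count (not ∘ isLeaf T) ≡ n ∸ numLeaves T
    internal-count = sym (trans (cong (_∸ numLeaves T) (sym (count-complement (isLeaf T))))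
                                (m+n∸m≡n (numLeaves T) _))

  SupportDominated : Set
  SupportDominated = ∀ v → isSupport T v ≡ false → isLeaf T v ≡ false →
                     ∃[ u ] (isSupport T u ≡ true × Arc T u v)

  supportParent? : ∀ v → ∃[ u ] (isSupport T u ≡ true × Arc T u v) ⊎
                         (∀ {p} → Arc T p v → isSupport T p ≡ false)
  supportParent? v with par v
  ... | nothing = inj₂ λ ()
  ... | just p with isSupport T p in support
  ...   | true  = inj₁ (p , support , refl)
  ...   | false = inj₂ λ p≡p′ → subst (λ q → isSupport T q ≡ false) (just-injective p≡p′) support

  leaf-or-support : n ≡ numLeaves T + numSupport T → ∀ x → isLeaf T x ∨ isSupport T x ≡ true
  leaf-or-support n≡ℓ+s = count≡n⇒all (begin
    count (λ x → isLeaf T x ∨ isSupport T x)           ≡⟨ count-split _ (isLeaf T) ⟩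
    count (λ x → (isLeaf T x ∨ isSupport T x) ∧ isLeaf T x) +
    count (λ x → (isLeaf T x ∨ isSupport T x) ∧ not (isLeaf T x))
                                                       ≡⟨ cong₂ _+_ (count-cong leaves) (count-cong supports) ⟩
    numLeaves T + numSupport T                         ≡⟨ n≡ℓ+s ⟨
    n                                                  ∎)
    where
    open ≡-Reasoning
    leaves : ∀ x → (isLeaf T x ∨ isSupport T x) ∧ isLeaf T x ≡ isLeaf T x
    leaves x with isLeaf T x
    ... | true  = refl
    ... | false = ∧-zeroʳ _
    supports : ∀ x → (isLeaf T x ∨ isSupport T x) ∧ not (isLeaf T x) ≡ isSupport T x
    supports x with isLeaf T x in leaf | isSupport T x in support
    ... | false | s     = ∧-identityʳ s
    ... | true  | false = refl
    ... | true  | true  = case trans (sym leaf) (isSupport⇒¬isLeaf support) of λ ()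

  numSupport≤ρ : 2 ≤ n → ∀ {ρ} → PackingNumber T ρ → numSupport T ≤ ρ
  numSupport≤ρ 2≤n (_ , maximal) =
    subst (_≤ _) (count-keptLeaf 2≤n) (maximal keptLeaf (Scattered⇒IsPacking keptLeaf-scattered))

  -- The kept leaves together with v still form a packing.
  numSupport<ρ : 2 ≤ n → ∀ {ρ} → PackingNumber T ρ →
                 ∀ {v} → isSupport T v ≡ false → isLeaf T v ≡ false →
                 (∀ {p} → Arc T p v → isSupport T p ≡ false) → numSupport T < ρ
  numSupport<ρ 2≤n (_ , maximal) {v} ¬support ¬leaf no-support-parent = begin-strict
    numSupport T                          ≡⟨ count-keptLeaf 2≤n ⟨
    count keptLeaf                        <⟨ n<1+n _ ⟩
    suc (count keptLeaf)                  ≡⟨ count-insert v (cong (_∧ keptInT′ T v) ¬leaf) ⟨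
    count (λ x → ⌊ x ≟ v ⌋ ∨ keptLeaf x)
      ≤⟨ maximal _ (Scattered⇒IsPacking (Scattered-insert v keptLeaf-scattered apart)) ⟩
    _                                     ∎
    where
    open ≤-Reasoning
    apart : ∀ {x} → keptLeaf x ≡ true → x ≢ v → Apart v x
    apart kept _ =
      let leaf = proj₁ (∧≡true kept) in
        (λ vx → case trans (sym ¬support) (leafChild⇒isSupport vx leaf) of λ ())
      , isLeaf⇒¬Arc leaf
      , λ pv px → case trans (sym (no-support-parent pv)) (leafChild⇒isSupport px leaf) of λ ()

  ρ≤numSupport : ∀ {ρ} → PackingNumber T ρ →
                 (∀ x → ∃[ u ] (isSupport T u ≡ true × inN⁺ T u x ≡ true)) → ρ ≤ numSupport T
  ρ≤numSupport ((B , packing , count≡ρ) , _) dominated =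
    subst (_≤ _) count≡ρ (count-≤-cover (inN⁺ T) packing λ x _ → dominated x)

  supports-dominate : 2 ≤ n → SupportDominated →
                      ∀ x → ∃[ u ] (isSupport T u ≡ true × inN⁺ T u x ≡ true)
  supports-dominate 2≤n dominated x with isSupport T x in support | isLeaf T x in leaf
  ... | true  | _     = x , support , inN⁺-refl x
  ... | false | true  = let p , px = leaf-has-parent 2≤n leaf in p , leafChild⇒isSupport px leaf , Arc⇒inN⁺ px
  ... | false | false = let u , su , ux = dominated x support leaf in u , su , Arc⇒inN⁺ ux

  ρ≡numSupport⇔ : 2 ≤ n → ∀ ρ → PackingNumber T ρ →
    (ρ ≡ numSupport T ⇔
      (n ≡ numLeaves T + numSupport T ⊎ (¬ (n ≡ numLeaves T + numSupport T) × SupportDominated)))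
  ρ≡numSupport⇔ 2≤n ρ pn = mk⇔ to from
    where
    to : ρ ≡ numSupport T → _
    to ρ≡s with n ≟ℕ numLeaves T + numSupport T
    ... | yes n≡ℓ+s = inj₁ n≡ℓ+s
    ... | no  n≢ℓ+s = inj₂ (n≢ℓ+s , dominated)
      where
      dominated : SupportDominated
      dominated v ¬support ¬leaf with supportParent? v
      ... | inj₁ found     = found
      ... | inj₂ no-parent = ⊥-elim (<-irrefl (sym ρ≡s) (numSupport<ρ 2≤n pn ¬support ¬leaf no-parent))
    from : _ → ρ ≡ numSupport T
    from condition = ≤-antisym (ρ≤numSupport pn (supports-dominate 2≤n dominated)) (numSupport≤ρ 2≤n pn)
      where
      dominated : SupportDominated
      dominated = case condition of λ where
        (inj₁ n≡ℓ+s) v ¬support ¬leaf →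
          case trans (sym (leaf-or-support n≡ℓ+s v)) (cong₂ _∨_ ¬leaf ¬support) of λ ()
        (inj₂ (_ , dominated)) → dominated

  anc-suc : ∀ k z → anc par (suc k) z ≡ (anc par k z >>= par)
  anc-suc zero    z with par z
  ... | nothing = refl
  ... | just _  = refl
  anc-suc (suc k) z with par z
  ... | nothing = refl
  ... | just p  = anc-suc k p

  PathIn-end : ∀ {A x z k} → PathIn T A x z k → A z ≡ true
  PathIn-end (here az)       = az
  PathIn-end (next _ _ rest) = PathIn-end rest

  PathIn-snoc : ∀ {A x y z k} → PathIn T A x y k → A z ≡ true → Arc T y z → PathIn T A x z (suc k)
  PathIn-snoc (here ax)          az yz = next ax yz (here az)
  PathIn-snoc (next ax xy′ rest) az yz = next ax xy′ (PathIn-snoc rest az yz)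

  PathIn⇒anc : ∀ {A x z k} → PathIn T A x z k → anc par k z ≡ just x
  PathIn⇒anc (here _) = refl
  PathIn⇒anc {z = z} (next {k = k} _ xy rest) =
    trans (anc-suc k z) (trans (cong (_>>= par) (PathIn⇒anc rest)) xy)

  anc⇒PathIn : ∀ {A} → AncestorClosed A → ∀ k {x y} → anc par k x ≡ just y → A x ≡ true →
               PathIn T A y x k
  anc⇒PathIn closed zero    refl ax = here ax
  anc⇒PathIn closed (suc k) {x} x↑ ax with par x in px
  ... | just p = PathIn-snoc (anc⇒PathIn closed k x↑ (closed px ax)) ax px

  deepest⇒MaxDist : ∀ {A v} → (∀ {w} → A w ≡ true → depth w ≤ depth v) → MaxDist T A v
  deepest⇒MaxDist deepest w k k′ root→w root→v =
    subst₂ _≤_ (sym (depth-unique (PathIn⇒anc root→w))) (sym (depth-unique (PathIn⇒anc root→v)))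
      (deepest (PathIn-end root→w))

  MaxDist⇒deepest : ∀ {A v} → AncestorClosed A → A v ≡ true → MaxDist T A v →
                    ∀ {w} → A w ≡ true → depth w ≤ depth v
  MaxDist⇒deepest {v = v} closed av maxDist {w} aw =
    maxDist w (depth w) (depth v) (anc⇒PathIn closed (depth w) (proj₂ (connected w)) aw)
                                  (anc⇒PathIn closed (depth v) (proj₂ (connected v)) av)

  PathIn-start : ∀ {A x z k} → PathIn T A x z k → A x ≡ true
  PathIn-start (here ax)     = ax
  PathIn-start (next ax _ _) = ax

  root∈ : ∀ {A x} → AncestorClosed A → A x ≡ true → A root ≡ true
  root∈ {x = x} closed ax = PathIn-start (anc⇒PathIn closed (depth x) (proj₂ (connected x)) ax)

  remove⇒ : ∀ {A u x} → remove T A u x ≡ true → A x ≡ true × inN⁺ T u x ≡ false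
  remove⇒ {A} {u} {x} rx =
    let ax , x∉ = ∧≡true {A x} rx in ax , trans (sym (not-involutive _)) (cong not x∉)

  remove-closed : ∀ {A u v} → AncestorClosed A → A v ≡ true → MaxDist T A v → Arc T u v →
                  AncestorClosed (remove T A u)
  remove-closed {A} {u} {v} closed av maxDist uv {p} {x} px rx with inN⁺ T u p in p∈
  ... | false = trans (∧-identityʳ _) (closed px (proj₁ (remove⇒ {A} {u} {x} rx)))
  ... | true with inN⁺⇒ p∈
  ...   | inj₁ refl = case trans (sym (Arc⇒inN⁺ px)) (proj₂ (remove⇒ {A} {u} {x} rx)) of λ ()
  ...   | inj₂ up   = ⊥-elim (1+n≰n (begin
    suc (depth v)  ≡⟨ cong suc (trans (depth-child uv) (sym (depth-child up))) ⟩
    suc (depth p)  ≡⟨ depth-child px ⟨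
    depth x        ≤⟨ MaxDist⇒deepest closed av maxDist (proj₁ (remove⇒ {A} {u} {x} rx)) ⟩
    depth v        ∎))
    where open ≤-Reasoning

  blockSize≥2 : ∀ {A u v} → A u ≡ true → A v ≡ true → Arc T u v → 2 ≤ blockSize T A u
  blockSize≥2 {A} {u} {v} au av uv = begin
    2                                      ≡⟨ cong suc (count-≟ v) ⟨
    suc (count (λ x → ⌊ x ≟ v ⌋))          ≡⟨ count-insert u u≟v≡false ⟨
    count (λ x → ⌊ x ≟ u ⌋ ∨ ⌊ x ≟ v ⌋)    ≤⟨ count-mono in-star ⟩
    blockSize T A u                        ∎
    where
    open ≤-Reasoning
    u≟v≡false : ⌊ u ≟ v ⌋ ≡ false
    u≟v≡false = fromWitnessFalse≡ (u ≟ v) λ { refl → Arc-irreflexive uv }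
    in-star : ∀ x → ⌊ x ≟ u ⌋ ∨ ⌊ x ≟ v ⌋ ≡ true → A x ∧ inN⁺ T u x ≡ true
    in-star x _ with x ≟ u | x ≟ v
    ... | yes refl | _        = cong₂ _∧_ au refl
    ... | no  _    | yes refl = cong₂ _∧_ av (Arc⇒arcB uv)

  endSize : Ending T → ℕ
  endSize emptyEnd  = 0
  endSize singleEnd = 1

  Elim-count : ∀ {A ks e} → Elim T A ks e → count A ≡ sum ks + endSize e
  Elim-count (stopEmpty none)       = count-none none
  Elim-count (stopSingle x ax only) = count-single x ax only
  Elim-count {A} (step {ks} {e} _ u _ _ _ _ rest) = begin
    count A                                         ≡⟨ count-split A (inN⁺ T u) ⟩
    blockSize T A u + count (remove T A u)          ≡⟨ cong (blockSize T A u +_) (Elim-count rest) ⟩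
    blockSize T A u + (sum ks + endSize e)          ≡⟨ +-assoc (blockSize T A u) (sum ks) (endSize e) ⟨
    sum (blockSize T A u ∷ ks) + endSize e          ∎
    where open ≡-Reasoning

  Elim-blocks≥2 : ∀ {A ks e} → Elim T A ks e → All (2 ≤_) ks
  Elim-blocks≥2 (stopEmpty _)                   = []
  Elim-blocks≥2 (stopSingle _ _ _)              = []
  Elim-blocks≥2 (step _ _ (av , _) _ au uv rest) = blockSize≥2 au av uv ∷ Elim-blocks≥2 rest

  count-insert-removed : ∀ {A u y} {B : Fin n → Bool} →
                         (∀ {x} → B x ≡ true → remove T A u x ≡ true) → inN⁺ T u y ≡ true →
                         count (λ x → ⌊ x ≟ y ⌋ ∨ B x) ≡ suc (count B)
  count-insert-removed {A} {u} {y} {B} B⊆ y∈ = count-insert y By≡false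
    where
    By≡false : B y ≡ false
    By≡false with B y in by
    ... | false = refl
    ... | true  = case trans (sym y∈) (proj₂ (remove⇒ {A} {u} (B⊆ by))) of λ ()

  chosen centres : ∀ {A ks e} → Elim T A ks e → Fin n → Bool
  chosen (stopEmpty _)              _ = false
  chosen (stopSingle x _ _)         y = ⌊ y ≟ x ⌋
  chosen (step v _ _ _ _ _ rest)    y = ⌊ y ≟ v ⌋ ∨ chosen rest y
  centres (stopEmpty _)             _ = false
  centres (stopSingle x _ _)        y = ⌊ y ≟ x ⌋
  centres (step _ u _ _ _ _ rest)   y = ⌊ y ≟ u ⌋ ∨ centres rest y

  chosen⊆ : ∀ {A ks e} (r : Elim T A ks e) {x} → chosen r x ≡ true → A x ≡ true
  chosen⊆ (stopSingle x₀ ax₀ _) {x} eq with refl ← toWitness≡ (x ≟ x₀) eq = ax₀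
  chosen⊆ (step v _ (av , _) _ _ _ rest) {x} eq with x ≟ v
  ... | yes refl = av
  ... | no  _    = proj₁ (∧≡true (chosen⊆ rest eq))

  centres⊆ : ∀ {A ks e} (r : Elim T A ks e) {x} → centres r x ≡ true → A x ≡ true
  centres⊆ (stopSingle x₀ ax₀ _) {x} eq with refl ← toWitness≡ (x ≟ x₀) eq = ax₀
  centres⊆ (step _ u _ _ au _ rest) {x} eq with x ≟ u
  ... | yes refl = au
  ... | no  _    = proj₁ (∧≡true (centres⊆ rest eq))

  count-chosen : ∀ {A ks e} (r : Elim T A ks e) → count (chosen r) ≡ length ks + endSize e
  count-chosen (stopEmpty _)            = count-none {n} {λ _ → false} λ _ → refl
  count-chosen (stopSingle x _ _)       = count-≟ x
  count-chosen (step _ _ _ _ _ uv rest) =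
    trans (count-insert-removed (chosen⊆ rest) (Arc⇒inN⁺ uv)) (cong suc (count-chosen rest))

  count-centres : ∀ {A ks e} (r : Elim T A ks e) → count (centres r) ≡ length ks + endSize e
  count-centres (stopEmpty _)           = count-none {n} {λ _ → false} λ _ → refl
  count-centres (stopSingle x _ _)      = count-≟ x
  count-centres (step _ u _ _ _ _ rest) =
    trans (count-insert-removed (centres⊆ rest) (inN⁺-refl u)) (cong suc (count-centres rest))

  chosen-scattered : ∀ {A ks e} (r : Elim T A ks e) → Scattered (chosen r)
  chosen-scattered (stopEmpty _) ()
  chosen-scattered (stopSingle x₀ _ _) {x} {y} eq-x eq-y x≢y
    with refl ← toWitness≡ (x ≟ x₀) eq-x | refl ← toWitness≡ (y ≟ x₀) eq-y = ⊥-elim (x≢y refl)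
  chosen-scattered {A} (step v u (_ , v-leaf) _ _ uv rest) =
    Scattered-insert v (chosen-scattered rest) apart
    where
    apart : ∀ {x} → chosen rest x ≡ true → x ≢ v → Apart v x
    apart {x} cx _ =
      let ax , x∉ = remove⇒ {A} {u} (chosen⊆ rest cx)
          u∌x : ¬ Arc T u x
          u∌x ux = case trans (sym (Arc⇒inN⁺ ux)) x∉ of λ ()
      in v-leaf x ax
       , (λ xv → case trans (sym (inN⁺-refl u))
                           (subst (λ w → inN⁺ T u w ≡ false) (Arc-functional xv uv) x∉) of λ ())
       , λ pv px → u∌x (subst (λ p → Arc T p x) (Arc-functional pv uv) px)

  centres-dominate : ∀ {A ks e} (r : Elim T A ks e) {x} → A x ≡ true →
                     ∃[ u ] (centres r u ≡ true × inN⁺ T u x ≡ true)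
  centres-dominate (stopEmpty none) {x} ax = case trans (sym ax) (none x) of λ ()
  centres-dominate (stopSingle x₀ _ only) {x} ax with refl ← only x ax =
    x , fromWitness≡ (x ≟ x) refl , inN⁺-refl x
  centres-dominate (step _ u _ _ _ _ rest) {x} ax with inN⁺ T u x in x∈
  ... | true  = u , cong (_∨ centres rest u) (fromWitness≡ (u ≟ u) refl) , x∈
  ... | false =
    let w , cw , w∋x = centres-dominate rest (cong₂ _∧_ ax (cong not x∈))
    in w , trans (cong (⌊ w ≟ u ⌋ ∨_) cw) (∨-zeroʳ _) , w∋x

  centres-parent : ∀ {A ks e} → AncestorClosed A → (r : Elim T A ks e) →
                   ∀ {x} → A x ≡ true → isLeaf T x ≡ true → x ≢ root →
                   ∃[ u ] (centres r u ≡ true × Arc T u x)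
  centres-parent _ (stopEmpty none) {x} ax _ _ = case trans (sym ax) (none x) of λ ()
  centres-parent closed (stopSingle x₀ _ only) {x} ax _ x≢root =
    ⊥-elim (x≢root (trans (only x ax) (sym (only root (root∈ closed ax)))))
  centres-parent {A} closed (step _ u (av , _) maxDist _ uv rest) {x} ax leaf x≢root
    with inN⁺ T u x in x∈
  ... | true with inN⁺⇒ {u} {x} x∈
  ...   | inj₁ refl = ⊥-elim (isLeaf⇒¬Arc leaf uv)
  ...   | inj₂ ux   = u , cong (_∨ centres rest u) (fromWitness≡ (u ≟ u) refl) , ux
  centres-parent {A} closed (step _ u (av , _) maxDist _ uv rest) {x} ax leaf x≢root | false =
    let w , cw , wx = centres-parent (remove-closed closed av maxDist uv) rest
                        (cong₂ _∧_ ax (cong not x∈)) leaf x≢root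
    in w , trans (cong (⌊ w ≟ u ⌋ ∨_) cw) (∨-zeroʳ _) , wx

  deepestLeafStar : ∀ {A v} → AncestorClosed A → A v ≡ true → v ≢ root →
                    ∃[ m ] ∃[ u ] (IsLeafIn T A m × MaxDist T A m × A u ≡ true × Arc T u m)
  deepestLeafStar {A} {v} closed av v≢root =
    m , u , (am , m-leaf) , deepest⇒MaxDist m-deepest , closed um am , um
    where
    deepest = argmax A depth av
    m = proj₁ deepest
    am = proj₁ (proj₂ deepest)
    m-deepest : ∀ {w} → A w ≡ true → depth w ≤ depth m
    m-deepest = proj₂ (proj₂ deepest)
    m≢root : m ≢ root
    m≢root m≡root = v≢root (depth≡0⇒root (n≤0⇒n≡0 (begin
      depth v     ≤⟨ m-deepest av ⟩
      depth m     ≡⟨ cong depth m≡root ⟩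
      depth root  ≡⟨ depth-unique {0} {root} refl ⟨
      0           ∎)))
      where open ≤-Reasoning
    parent = nonRoot⇒parent m≢root
    u = proj₁ parent
    um = proj₂ parent
    m-leaf : ∀ w → A w ≡ true → ¬ Arc T m w
    m-leaf w aw mw = 1+n≰n (subst (_≤ depth m) (depth-child mw) (m-deepest aw))

  elimination : ∀ {A} → AncestorClosed A → ∃[ ks ] ∃[ e ] Elim T A ks e
  elimination {A} = run (<-wellFounded (count A))
    where
    run : ∀ {A} → Acc _<_ (count A) → AncestorClosed A → ∃[ ks ] ∃[ e ] Elim T A ks e
    run {A} (acc smaller) closed with any? (λ v → (A v ≟ᴮ true) ×-dec ¬? (v ≟ root))
    ... | yes (v , av , v≢root) =
      let m , u , m-leaf@(am , _) , maxDist , au , um = deepestLeafStar closed av v≢root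
          shrinks : count (remove T A u) < count A
          shrinks = subst (count (remove T A u) <_) (sym (count-split A (inN⁺ T u)))
                      (m<n+m _ (≤-trans (s≤s z≤n) (blockSize≥2 au am um)))
          ks , e , r = run (smaller shrinks) (remove-closed closed am maxDist um)
      in blockSize T A u ∷ ks , e , step m u m-leaf maxDist au um r
    ... | no none with A root in a-root
    ...   | true  = [] , singleEnd , stopSingle root a-root only-root
      where
      only-root : ∀ v → A v ≡ true → v ≡ root
      only-root v av with v ≟ root
      ... | yes v≡root = v≡root
      ... | no  v≢root = ⊥-elim (none (v , av , v≢root))
    ...   | false = [] , emptyEnd , stopEmpty empty
      where
      empty : ∀ v → A v ≡ false
      empty v with A v in av | v ≟ root
      ... | false | _          = refl
      ... | true  | yes refl   = case trans (sym av) a-root of λ ()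
      ... | true  | no  v≢root = ⊥-elim (none (v , av , v≢root))

  centres-dominate-T′ : 2 ≤ n → ∀ {ks e} (r : Elim T (keptInT′ T) ks e) →
                        ∀ x → ∃[ u ] (centres r u ≡ true × inN⁺ T u x ≡ true)
  centres-dominate-T′ 2≤n r x with keptInT′ T x in kept
  ... | true  = centres-dominate r kept
  ... | false =
    let leaf = ¬keptInT′⇒isLeaf kept
        p , px = leaf-has-parent 2≤n leaf
        m , pm , kept-m = keptLeaf-exists px leaf
        leaf-m , T′-m = ∧≡true kept-m
        u , cu , um = centres-parent T′-closed r T′-m leaf-m λ m≡root → ¬Arc-root (subst (Arc T p) m≡root pm)
    in u , cu , Arc⇒inN⁺ (subst (λ q → Arc T q x) (Arc-functional pm um) px)

  ρ≡run : 2 ≤ n → ∀ {ρ ks e} → PackingNumber T ρ → Elim T (keptInT′ T) ks e →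
          ρ ≡ length ks + endSize e
  ρ≡run 2≤n ((B , packing , count≡ρ) , maximal) r = ≤-antisym
    (subst₂ _≤_ count≡ρ (count-centres r)
      (count-≤-cover (inN⁺ T) packing λ x _ → centres-dominate-T′ 2≤n r x))
    (subst (_≤ _) (count-chosen r) (maximal (chosen r) (Scattered⇒IsPacking (chosen-scattered r))))

  PhiShape : List ℕ → Ending T → Set
  PhiShape ks emptyEnd  = All (_≡ 2) ks
  PhiShape ks singleEnd =
    All (_≡ 2) ks ⊎ ∃[ ks₁ ] ∃[ ks₂ ] (ks ≡ ks₁ ++ 3 ∷ ks₂ × All (_≡ 2) ks₁ × All (_≡ 2) ks₂)

  InΦ⇔PhiShape : ∀ {A} → InΦ T A ⇔ (∃[ ks ] ∃[ e ] (Elim T A ks e × PhiShape ks e))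
  InΦ⇔PhiShape = mk⇔
    (λ where
      (inj₁ (ks , r , twos))                         → ks , emptyEnd , r , twos
      (inj₂ (inj₁ (ks , r , twos)))                  → ks , singleEnd , r , inj₁ twos
      (inj₂ (inj₂ (ks₁ , ks₂ , r , twos₁ , twos₂))) →
        _ , singleEnd , r , inj₂ (ks₁ , ks₂ , refl , twos₁ , twos₂))
    (λ where
      (ks , emptyEnd , r , twos)                                 → inj₁ (ks , r , twos)
      (ks , singleEnd , r , inj₁ twos)                           → inj₂ (inj₁ (ks , r , twos))
      (_ , singleEnd , r , inj₂ (ks₁ , ks₂ , refl , twos₁ , twos₂)) →
        inj₂ (inj₂ (ks₁ , ks₂ , r , twos₁ , twos₂)))

  PhiShape⇔ : ∀ {ks} e → All (2 ≤_) ks →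
              (PhiShape ks e ⇔ sum ks + endSize e ≤ (length ks + endSize e) + (length ks + endSize e))
  PhiShape⇔ {ks} emptyEnd blocks
    rewrite +-identityʳ (sum ks) | +-identityʳ (length ks) =
    mk⇔ (≤-reflexive ∘ sum-all≡2) (all≡2 blocks)
  PhiShape⇔ {ks} singleEnd blocks
    rewrite +-comm (sum ks) 1 | +-comm (length ks) 1 | +-suc (length ks) (length ks) =
    mk⇔ (s≤s ∘ λ where
           (inj₁ twos)                            → ≤-trans (≤-reflexive (sum-all≡2 twos)) (n≤1+n _)
           (inj₂ (ks₁ , ks₂ , refl , twos₁ , twos₂)) → ≤-reflexive (sum-one-3 twos₁ twos₂))
        (all≡2-or-one-3 blocks ∘ s≤s⁻¹)

  run-double≤ : ∀ {ks} e → All (2 ≤_) ks →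
                (length ks + endSize e) + (length ks + endSize e) ≤ suc (sum ks + endSize e)
  run-double≤ {ks} emptyEnd blocks rewrite +-identityʳ (sum ks) | +-identityʳ (length ks) =
    ≤-trans (sum≥double blocks) (n≤1+n _)
  run-double≤ {ks} singleEnd blocks
    rewrite +-comm (sum ks) 1 | +-comm (length ks) 1 | +-suc (length ks) (length ks) =
    s≤s (s≤s (sum≥double blocks))

  ρ≡⌈/2⌉⇔PhiShape : 2 ≤ n → ∀ {ρ ks e} → PackingNumber T ρ → (r : Elim T (keptInT′ T) ks e) →
                    (ρ ≡ ⌈ n ∸ numLeaves T + numSupport T /2⌉ ⇔ PhiShape ks e)
  ρ≡⌈/2⌉⇔PhiShape 2≤n {e = e} pn r
    rewrite ρ≡run 2≤n pn r | trans (sym (count-T′ 2≤n)) (Elim-count r) =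
    ⇔-trans (≡⌈/2⌉⇔≤double (run-double≤ e blocks)) (⇔-sym (PhiShape⇔ e blocks))
    where blocks = Elim-blocks≥2 r

  ρ≡⌈/2⌉⇔InΦ : 2 ≤ n → ∀ ρ → PackingNumber T ρ →
               (ρ ≡ ⌈ n ∸ numLeaves T + numSupport T /2⌉ ⇔ InΦ T (keptInT′ T))
  ρ≡⌈/2⌉⇔InΦ 2≤n ρ pn = mk⇔
    (λ ρ≡⌈/2⌉ → let ks , e , r = elimination T′-closed in
      Equivalence.from InΦ⇔PhiShape (ks , e , r , Equivalence.to (ρ≡⌈/2⌉⇔PhiShape 2≤n pn r) ρ≡⌈/2⌉))
    (λ inΦ → let ks , e , r , shape = Equivalence.to InΦ⇔PhiShape inΦ in
             Equivalence.from (ρ≡⌈/2⌉⇔PhiShape 2≤n pn r) shape)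

theorem7 : ∀ {n} (T : RootedTree n) → 2 ≤ n →
    (∀ ρ → PackingNumber T ρ →
      (ρ ≡ numSupport T ⇔
        (n ≡ numLeaves T + numSupport T ⊎
          (¬ (n ≡ numLeaves T + numSupport T) ×
            (∀ v → isSupport T v ≡ false → isLeaf T v ≡ false →
              ∃[ u ] (isSupport T u ≡ true × Arc T u v))))))
    ×
    (∀ ρ → PackingNumber T ρ →
      (ρ ≡ ⌈ n ∸ numLeaves T + numSupport T /2⌉ ⇔ InΦ T (keptInT′ T)))
theorem7 T 2≤n = ρ≡numSupport⇔ T 2≤n , ρ≡⌈/2⌉⇔InΦ T 2≤n
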